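{- The abstraction map $\mathrm{abs}:(\mathcal{I}_k,\oplus)\to(\mathcal{A}_k,\boxplus)$ is a semigroup homomorphism, i.e., for all $I_1,I_2\in\mathcal{I}_k$, $\mathrm{abs}(I_1\oplus I_2)=\mathrm{abs}(I_1)\boxplus\mathrm{abs}(I_2)$.
   Context: Let $k$ be a positive integer. A $k$-interface graph is a tuple $(G,\phi,L,R)$ where $G$ is a finite simple graph, $L,R\subseteq V(G)$, and $\phi:V(G)\to[k]$ is injective on each of $L$ and $R$. Two $k$-interface graphs $(G_1,\phi_1,L_1,R_1)$, $(G_2,\phi_2,L_2,R_2)$ are compatible if, with $J=\phi_1(R_1)\cap\phi_2(L_2)$, we have $V(G_1)\cap V(G_2)=\phi_1^{ -1}(J)\cap R_1=\phi_2^{ -1}(J)\cap L_2$ and $\phi_1,\phi_2$ coincide on $V(G_1)\cap V(G_2)$; their gluing is $(G_1\cup G_2,\phi,L_1,R_2)$ with $\phi$ the common extension. Isomorphism of $k$-interface graphs is a graph isomorphism preserving labels, membership in $L$ and in $R$; $\mathcal{I}_k$ is the set of isomorphism classes, and $I_1\oplus I_2$ is the class of the gluing of compatible representatives of $I_1,I_2$. The torso $\mathrm{torso}(G,X)$ is the graph on $X$ where $x_1\neq x_2$ are adjacent iff joined in $G$ by a path with no internal vertex in $X$. The abstraction $\mathrm{abs}(\mathbb{G})$ of $\mathbb{G}=(G,\phi,L,R)$ is the isomorphism class of $(\mathrm{torso}(G,L\cup R),\phi|_{L\cup R},L,R)$; for $I\in\mathcal{I}_k$, $\mathrm{abs}(I)$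 is the abstraction of any representative. $\mathcal{A}_k$ is the set of all abstractions, and for $A_1,A_2\in\mathcal{A}_k$, $A_1\boxplus A_2:=\mathrm{abs}(A_1\oplus A_2)$ (an associative operation). -}

module Defs where

open import Data.Nat using (ℕ; _≟_)
open import Data.Fin using (Fin)
open import Data.List using (List; _++_)
open import Data.List.Membership.Propositional using (_∈_; _∉_)
open import Data.List.Membership.DecPropositional _≟_ using (_∈?_)
open import Data.Product using (Σ; ∃; _×_; _,_)
open import Data.Bool using (if_then_else_)
open import Relation.Nullary using (¬_; does)
open import Relation.Binary.PropositionalEquality using (_≡_; _≢_)
open import Function.Bundles using (_⇔_)

-- Raw k-interface graph: vertices are natural numbers; the vertex set V is a
-- finite list (only membership matters), E is the adjacency relation,
-- φ the labelling (only its values on V matter), L, R the interfaces.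
record IGraph (k : ℕ) : Set₁ where
  constructor igraph
  field
    V   : List ℕ
    E   : ℕ → ℕ → Set
    φ   : ℕ → Fin k
    L R : List ℕ

record WellFormed {k : ℕ} (G : IGraph k) : Set where
  open IGraph G
  field
    E-sym  : ∀ {x y} → E x y → E y x
    E-irr  : ∀ {x} → ¬ E x x
    E-V    : ∀ {x y} → E x y → x ∈ V × y ∈ V
    L⊆V    : ∀ {x} → x ∈ L → x ∈ V
    R⊆V    : ∀ {x} → x ∈ R → x ∈ V
    φ-injL : ∀ {x y} → x ∈ L → y ∈ L → φ x ≡ φ y → x ≡ y
    φ-injR : ∀ {x y} → x ∈ R → y ∈ R → φ x ≡ φ y → x ≡ y

record Compatible {k : ℕ} (G₁ G₂ : IGraph k) : Set where
  private
    module G₁ = IGraph G₁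
    module G₂ = IGraph G₂
  InJ : Fin k → Set
  InJ j = (∃ λ r → r ∈ G₁.R × G₁.φ r ≡ j) × (∃ λ l → l ∈ G₂.L × G₂.φ l ≡ j)
  field
    overlap₁ : ∀ x → (x ∈ G₁.V × x ∈ G₂.V) ⇔ (x ∈ G₁.R × InJ (G₁.φ x))
    overlap₂ : ∀ x → (x ∈ G₁.V × x ∈ G₂.V) ⇔ (x ∈ G₂.L × InJ (G₂.φ x))
    agree    : ∀ {x} → x ∈ G₁.V → x ∈ G₂.V → G₁.φ x ≡ G₂.φ x

-- Gluing (meaningful for compatible G₁, G₂): union graph, common extension of
-- the labellings, left interface L₁, right interface R₂.
data UnionEdge {k : ℕ} (G₁ G₂ : IGraph k) (x y : ℕ) : Set where
  inl : IGraph.E G₁ x y → UnionEdge G₁ G₂ x y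
  inr : IGraph.E G₂ x y → UnionEdge G₁ G₂ x y

glue : {k : ℕ} → IGraph k → IGraph k → IGraph k
glue G₁ G₂ = igraph
  (IGraph.V G₁ ++ IGraph.V G₂)
  (UnionEdge G₁ G₂)
  (λ x → if does (x ∈? IGraph.V G₁) then IGraph.φ G₁ x else IGraph.φ G₂ x)
  (IGraph.L G₁)
  (IGraph.R G₂)

-- Walks in G from x to y all of whose internal vertices lie outside X
-- (existence of such a walk is equivalent to existence of such a path).
data AvoidPath {k : ℕ} (G : IGraph k) (X : List ℕ) : ℕ → ℕ → Set where
  edge : ∀ {x y} → IGraph.E G x y → AvoidPath G X x y
  step : ∀ {x z y} → IGraph.E G x z → z ∉ X → AvoidPath G X z y → AvoidPath G X x y

TorsoEdge : {k : ℕ} → IGraph k → List ℕ → ℕ → ℕ → Set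
TorsoEdge G X x y = x ≢ y × x ∈ X × y ∈ X × AvoidPath G X x y

-- Representative of abs(G): (torso(G, L ∪ R), φ|_{L∪R}, L, R).
abs : {k : ℕ} → IGraph k → IGraph k
abs G = igraph (L ++ R) (TorsoEdge G (L ++ R)) φ L R
  where open IGraph G

record _≅_ {k : ℕ} (G H : IGraph k) : Set where
  private
    module G = IGraph G
    module H = IGraph H
  field
    f g   : ℕ → ℕ
    f∈    : ∀ {x} → x ∈ G.V → f x ∈ H.V
    g∈    : ∀ {y} → y ∈ H.V → g y ∈ G.V
    gf    : ∀ {x} → x ∈ G.V → g (f x) ≡ x
    fg    : ∀ {y} → y ∈ H.V → f (g y) ≡ y
    edges : ∀ {x y} → x ∈ G.V → y ∈ G.V → G.E x y ⇔ H.E (f x) (f y)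
    label : ∀ {x} → x ∈ G.V → H.φ (f x) ≡ G.φ x
    left  : ∀ {x} → x ∈ G.V → (x ∈ G.L) ⇔ (f x ∈ H.L)
    right : ∀ {x} → x ∈ G.V → (x ∈ G.R) ⇔ (f x ∈ H.R)

-- The boundary of G₁ ⊕ G₂ is contained in the union of the boundaries of the two
-- pieces, and every vertex shared by the pieces lies on both boundaries.  Hence an
-- avoiding path of G₁ ⊕ G₂ between two of its boundary vertices splits, at the
-- boundary vertices of the pieces it visits, into segments that run inside one
-- piece and avoid that piece's boundary, i.e. into torso edges of abs G₁ and
-- abs G₂; conversely each torso edge expands back into such a segment.  So the
-- identity on vertices is an isomorphism abs (G₁ ⊕ G₂) ≅ abs (abs G₁ ⊕ abs G₂),
-- and the theorem follows because gluing and abstraction respect isomorphism.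
module Submission where

open import Data.Nat using (ℕ; NonZero; _≟_)
open import Data.Bool using (if_then_else_)
open import Data.List using (List; _++_)
open import Data.List.Membership.Propositional using (_∈_; _∉_)
open import Data.List.Membership.DecPropositional _≟_ using (_∈?_)
open import Data.List.Membership.Propositional.Properties using (∈-++⁺ˡ; ∈-++⁺ʳ; ∈-++⁻)
open import Data.Product using (_×_; _,_; proj₁; proj₂; uncurry)
open import Data.Sum using (_⊎_; inj₁; inj₂; [_,_]′)
open import Data.Empty using (⊥-elim)
open import Function using (id; _∘_)
open import Function.Bundles using (_⇔_; mk⇔; Equivalence)
open import Function.Construct.Identity using (⇔-id)
open import Relation.Nullary using (yes; no; does)
open import Relation.Binary.PropositionalEquality
  using (_≡_; _≢_; refl; sym; trans; cong; subst; subst₂; module ≡-Reasoning)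
open import Relation.Binary.Construct.Closure.Reflexive using (ReflClosure; refl; [_])
open import Defs

open Equivalence using (to; from)

private
  variable
    k : ℕ
    x y z : ℕ

boundary : IGraph k → List ℕ
boundary G = IGraph.L G ++ IGraph.R G

boundary⊆V : {G : IGraph k} → WellFormed G → x ∈ boundary G → x ∈ IGraph.V G
boundary⊆V {G = G} w x∈ with ∈-++⁻ (IGraph.L G) x∈
... | inj₁ l = WellFormed.L⊆V w l
... | inj₂ r = WellFormed.R⊆V w r

glue-boundary⊆ : {G₁ G₂ : IGraph k} → x ∈ boundary (glue G₁ G₂) →
  x ∈ boundary G₁ ⊎ x ∈ boundary G₂
glue-boundary⊆ {G₁ = G₁} {G₂} x∈ with ∈-++⁻ (IGraph.L G₁) x∈
... | inj₁ l = inj₁ (∈-++⁺ˡ l)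
... | inj₂ r = inj₂ (∈-++⁺ʳ (IGraph.L G₂) r)

shared⊆boundaryˡ : {G₁ G₂ : IGraph k} → Compatible G₁ G₂ →
  x ∈ IGraph.V G₁ → x ∈ IGraph.V G₂ → x ∈ boundary G₁
shared⊆boundaryˡ {G₁ = G₁} c v₁ v₂ =
  ∈-++⁺ʳ (IGraph.L G₁) (proj₁ (to (Compatible.overlap₁ c _) (v₁ , v₂)))

shared⊆boundaryʳ : {G₁ G₂ : IGraph k} → Compatible G₁ G₂ →
  x ∈ IGraph.V G₁ → x ∈ IGraph.V G₂ → x ∈ boundary G₂
shared⊆boundaryʳ c v₁ v₂ = ∈-++⁺ˡ (proj₁ (to (Compatible.overlap₂ c _) (v₁ , v₂)))

piecewise : {A : Set} → List ℕ → (ℕ → A) → (ℕ → A) → ℕ → A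
piecewise xs a b x = if does (x ∈? xs) then a x else b x

piecewise-inˡ : {A : Set} {xs : List ℕ} (a b : ℕ → A) →
  x ∈ xs → piecewise xs a b x ≡ a x
piecewise-inˡ {x = x} {xs = xs} a b x∈ with x ∈? xs
... | yes _ = refl
... | no x∉ = ⊥-elim (x∉ x∈)

piecewise-inʳ : {A : Set} {xs ys : List ℕ} (a b : ℕ → A) →
  (∀ {x} → x ∈ xs → x ∈ ys → a x ≡ b x) →
  x ∈ ys → piecewise xs a b x ≡ b x
piecewise-inʳ {x = x} {xs = xs} a b agree x∈ys with x ∈? xs
... | yes x∈xs = agree x∈xs x∈ys
... | no _ = refl

glue-φˡ : (G₁ G₂ : IGraph k) → x ∈ IGraph.V G₁ →
  IGraph.φ (glue G₁ G₂) x ≡ IGraph.φ G₁ x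
glue-φˡ G₁ G₂ = piecewise-inˡ (IGraph.φ G₁) (IGraph.φ G₂)

glue-φʳ : {G₁ G₂ : IGraph k} → Compatible G₁ G₂ → x ∈ IGraph.V G₂ →
  IGraph.φ (glue G₁ G₂) x ≡ IGraph.φ G₂ x
glue-φʳ {G₁ = G₁} {G₂} c = piecewise-inʳ (IGraph.φ G₁) (IGraph.φ G₂) (Compatible.agree c)

record Hom (G H : IGraph k) : Set where
  private
    module G = IGraph G
    module H = IGraph H
  field
    f     : ℕ → ℕ
    f∈    : x ∈ G.V → f x ∈ H.V
    edges : x ∈ G.V → y ∈ G.V → G.E x y → H.E (f x) (f y)
    label : x ∈ G.V → H.φ (f x) ≡ G.φ x
    left  : x ∈ G.V → x ∈ G.L → f x ∈ H.L
    right : x ∈ G.V → x ∈ G.R → f x ∈ H.R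

_∘ₕ_ : {G H K : IGraph k} → Hom H K → Hom G H → Hom G K
h ∘ₕ h′ = record
  { f = h.f ∘ h′.f
  ; f∈ = h.f∈ ∘ h′.f∈
  ; edges = λ x∈ y∈ → h.edges (h′.f∈ x∈) (h′.f∈ y∈) ∘ h′.edges x∈ y∈
  ; label = λ x∈ → trans (h.label (h′.f∈ x∈)) (h′.label x∈)
  ; left = λ x∈ → h.left (h′.f∈ x∈) ∘ h′.left x∈
  ; right = λ x∈ → h.right (h′.f∈ x∈) ∘ h′.right x∈
  }
  where
  module h = Hom h
  module h′ = Hom h′

inverseHoms⇒≅ : {G H : IGraph k} (h : Hom G H) (h′ : Hom H G) →
  (∀ {x} → x ∈ IGraph.V G → Hom.f h′ (Hom.f h x) ≡ x) →
  (∀ {y} → y ∈ IGraph.V H → Hom.f h (Hom.f h′ y) ≡ y) →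
  G ≅ H
inverseHoms⇒≅ {G = G} h h′ h′h hh′ = record
  { f = h.f ; g = h′.f ; f∈ = h.f∈ ; g∈ = h′.f∈ ; gf = h′h ; fg = hh′
  ; edges = λ x∈ y∈ → mk⇔ (h.edges x∈ y∈)
      (subst₂ G.E (h′h x∈) (h′h y∈) ∘ h′.edges (h.f∈ x∈) (h.f∈ y∈))
  ; label = h.label
  ; left = λ x∈ → mk⇔ (h.left x∈) (subst (_∈ G.L) (h′h x∈) ∘ h′.left (h.f∈ x∈))
  ; right = λ x∈ → mk⇔ (h.right x∈) (subst (_∈ G.R) (h′h x∈) ∘ h′.right (h.f∈ x∈))
  }
  where
  module G = IGraph G
  module h = Hom h
  module h′ = Hom h′

≅⇒Hom : {G H : IGraph k} → G ≅ H → Hom G H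
≅⇒Hom i = record
  { f = f ; f∈ = f∈
  ; edges = λ x∈ y∈ → to (edges x∈ y∈)
  ; label = label
  ; left = to ∘ left
  ; right = to ∘ right
  }
  where open _≅_ i

≅⇒Hom⁻¹ : {G H : IGraph k} → G ≅ H → Hom H G
≅⇒Hom⁻¹ {H = H} i = record
  { f = g ; f∈ = g∈
  ; edges = λ y∈ y′∈ → from (edges (g∈ y∈) (g∈ y′∈)) ∘ subst₂ H.E (sym (fg y∈)) (sym (fg y′∈))
  ; label = λ y∈ → trans (sym (label (g∈ y∈))) (cong H.φ (fg y∈))
  ; left = λ y∈ → from (left (g∈ y∈)) ∘ subst (_∈ H.L) (sym (fg y∈))
  ; right = λ y∈ → from (right (g∈ y∈)) ∘ subst (_∈ H.R) (sym (fg y∈))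
  }
  where
  open _≅_ i
  module H = IGraph H

≅-sym : {G H : IGraph k} → G ≅ H → H ≅ G
≅-sym i = inverseHoms⇒≅ (≅⇒Hom⁻¹ i) (≅⇒Hom i) fg gf
  where open _≅_ i

≅-trans : {G H K : IGraph k} → G ≅ H → H ≅ K → G ≅ K
≅-trans i j = inverseHoms⇒≅ (≅⇒Hom j ∘ₕ ≅⇒Hom i) (≅⇒Hom⁻¹ i ∘ₕ ≅⇒Hom⁻¹ j)
  (λ x∈ → trans (cong i.g (j.gf (i.f∈ x∈))) (i.gf x∈))
  (λ z∈ → trans (cong j.f (i.fg (j.g∈ z∈))) (j.fg z∈))
  where
  module i = _≅_ i
  module j = _≅_ j

append : {G : IGraph k} {X : List ℕ} →
  AvoidPath G X x y → y ∉ X → AvoidPath G X y z → AvoidPath G X x z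
append (edge e) y∉ q = step e y∉ q
append (step e z∉ p) y∉ q = step e z∉ (append p y∉ q)

reflAppend : {G : IGraph k} {X : List ℕ} →
  ReflClosure (AvoidPath G X) x y → y ∉ X →
  ReflClosure (AvoidPath G X) y z → ReflClosure (AvoidPath G X) x z
reflAppend refl _ q = q
reflAppend [ p ] _ refl = [ p ]
reflAppend [ p ] y∉ [ q ] = [ append p y∉ q ]

reverse : {G : IGraph k} {X : List ℕ} → (∀ {a b} → IGraph.E G a b → IGraph.E G b a) →
  AvoidPath G X x y → AvoidPath G X y x
reverse E-sym (edge e) = edge (E-sym e)
reverse E-sym (step e z∉ p) = append (reverse E-sym p) z∉ (edge (E-sym e))

AvoidPath-map : {G H : IGraph k} {X Y : List ℕ} (f : ℕ → ℕ) →
  (∀ {a b} → IGraph.E G a b → IGraph.E H (f a) (f b)) →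
  (∀ {a b} → IGraph.E G a b → b ∉ X → f b ∉ Y) →
  AvoidPath G X x y → AvoidPath H Y (f x) (f y)
AvoidPath-map f f-edge f-avoid (edge e) = edge (f-edge e)
AvoidPath-map f f-edge f-avoid (step e z∉ p) =
  step (f-edge e) (f-avoid e z∉) (AvoidPath-map f f-edge f-avoid p)

abs-wellFormed : {G : IGraph k} → WellFormed G → WellFormed (abs G)
abs-wellFormed {G = G} w = record
  { E-sym = λ (x≢y , x∈ , y∈ , p) → x≢y ∘ sym , y∈ , x∈ , reverse E-sym p
  ; E-irr = λ (x≢x , _) → x≢x refl
  ; E-V = λ (_ , x∈ , y∈ , _) → x∈ , y∈
  ; L⊆V = ∈-++⁺ˡ
  ; R⊆V = ∈-++⁺ʳ (IGraph.L G)
  ; φ-injL = φ-injL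
  ; φ-injR = φ-injR
  }
  where open WellFormed w

glue-wellFormed : {G₁ G₂ : IGraph k} → WellFormed G₁ → WellFormed G₂ →
  Compatible G₁ G₂ → WellFormed (glue G₁ G₂)
glue-wellFormed {G₁ = G₁} {G₂} w₁ w₂ c = record
  { E-sym = λ { (inl e) → inl (w₁.E-sym e) ; (inr e) → inr (w₂.E-sym e) }
  ; E-irr = λ { (inl e) → w₁.E-irr e ; (inr e) → w₂.E-irr e }
  ; E-V = λ { (inl e) → ∈-++⁺ˡ (proj₁ (w₁.E-V e)) , ∈-++⁺ˡ (proj₂ (w₁.E-V e))
            ; (inr e) → ∈-++⁺ʳ G₁.V (proj₁ (w₂.E-V e)) , ∈-++⁺ʳ G₁.V (proj₂ (w₂.E-V e)) }
  ; L⊆V = ∈-++⁺ˡ ∘ w₁.L⊆V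
  ; R⊆V = ∈-++⁺ʳ G₁.V ∘ w₂.R⊆V
  ; φ-injL = λ x∈ y∈ eq → w₁.φ-injL x∈ y∈
      (trans (sym (glue-φˡ G₁ G₂ (w₁.L⊆V x∈))) (trans eq (glue-φˡ G₁ G₂ (w₁.L⊆V y∈))))
  ; φ-injR = λ x∈ y∈ eq → w₂.φ-injR x∈ y∈
      (trans (sym (glue-φʳ c (w₂.R⊆V x∈))) (trans eq (glue-φʳ c (w₂.R⊆V y∈))))
  }
  where
  module G₁ = IGraph G₁
  module w₁ = WellFormed w₁
  module w₂ = WellFormed w₂

abs-compatible : {G₁ G₂ : IGraph k} → WellFormed G₁ → WellFormed G₂ →
  Compatible G₁ G₂ → Compatible (abs G₁) (abs G₂)
abs-compatible {G₁ = G₁} {G₂} w₁ w₂ c = record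
  { overlap₁ = λ x → restrict (Compatible.overlap₁ c x)
  ; overlap₂ = λ x → restrict (Compatible.overlap₂ c x)
  ; agree = λ b₁ b₂ → Compatible.agree c (boundary⊆V w₁ b₁) (boundary⊆V w₂ b₂)
  }
  where
  restrict : {P : Set} → (x ∈ IGraph.V G₁ × x ∈ IGraph.V G₂) ⇔ P →
    (x ∈ boundary G₁ × x ∈ boundary G₂) ⇔ P
  restrict ov = mk⇔
    (λ (b₁ , b₂) → to ov (boundary⊆V w₁ b₁ , boundary⊆V w₂ b₂))
    (λ p → let (v₁ , v₂) = from ov p in shared⊆boundaryˡ c v₁ v₂ , shared⊆boundaryʳ c v₁ v₂)

module GlueHom {k : ℕ} {A₁ A₂ H₁ H₂ : IGraph k}
  (wA₁ : WellFormed A₁) (wA₂ : WellFormed A₂) (wH₂ : WellFormed H₂)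
  (cA : Compatible A₁ A₂) (cH : Compatible H₁ H₂)
  (h₁ : Hom A₁ H₁) (h₂ : Hom A₂ H₂) where

  private
    module A₁ = IGraph A₁
    module A₂ = IGraph A₂
    module H₁ = IGraph H₁
    module H₂ = IGraph H₂
    module wA₁ = WellFormed wA₁
    module wA₂ = WellFormed wA₂
    module h₁ = Hom h₁
    module h₂ = Hom h₂

  InJ-map : x ∈ A₁.V → Compatible.InJ cA (A₁.φ x) → Compatible.InJ cH (H₁.φ (h₁.f x))
  InJ-map v ((r , r∈ , r-label) , (l , l∈ , l-label)) =
      (h₁.f r , h₁.right r∈V r∈ , trans (h₁.label r∈V) (trans r-label (sym (h₁.label v))))
    , (h₂.f l , h₂.left l∈V l∈ , trans (h₂.label l∈V) (trans l-label (sym (h₁.label v))))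
    where
    r∈V = wA₁.R⊆V r∈
    l∈V = wA₂.L⊆V l∈

  -- A shared vertex lies in R(A₁) with a label in J, so its h₁-image is shared by
  -- H₁ and H₂ and hence lies in L(H₂), as does its h₂-image; both carry the same
  -- label, and labels are injective on L(H₂).
  agree-on-shared : x ∈ A₁.V → x ∈ A₂.V → h₁.f x ≡ h₂.f x
  agree-on-shared {x} v₁ v₂ = WellFormed.φ-injL wH₂ h₁x∈L₂ h₂x∈L₂ same-label
    where
    open ≡-Reasoning
    h₁x-shared : h₁.f x ∈ H₁.V × h₁.f x ∈ H₂.V
    h₁x-shared = let (x∈R , x∈J) = to (Compatible.overlap₁ cA x) (v₁ , v₂) in
      from (Compatible.overlap₁ cH (h₁.f x)) (h₁.right v₁ x∈R , InJ-map v₁ x∈J)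
    h₁x∈L₂ = proj₁ (to (Compatible.overlap₂ cH (h₁.f x)) h₁x-shared)
    h₂x∈L₂ = h₂.left v₂ (proj₁ (to (Compatible.overlap₂ cA x) (v₁ , v₂)))
    same-label : H₂.φ (h₁.f x) ≡ H₂.φ (h₂.f x)
    same-label = begin
      H₂.φ (h₁.f x) ≡⟨ sym (uncurry (Compatible.agree cH) h₁x-shared) ⟩
      H₁.φ (h₁.f x) ≡⟨ h₁.label v₁ ⟩
      A₁.φ x        ≡⟨ Compatible.agree cA v₁ v₂ ⟩
      A₂.φ x        ≡⟨ sym (h₂.label v₂) ⟩
      H₂.φ (h₂.f x) ∎

  map : ℕ → ℕ
  map = piecewise A₁.V h₁.f h₂.f

  map₁ : x ∈ A₁.V → map x ≡ h₁.f x
  map₁ = piecewise-inˡ h₁.f h₂.f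

  map₂ : x ∈ A₂.V → map x ≡ h₂.f x
  map₂ = piecewise-inʳ h₁.f h₂.f agree-on-shared

  hom : Hom (glue A₁ A₂) (glue H₁ H₂)
  hom = record
    { f = map
    ; f∈ = [ (λ v → ∈-++⁺ˡ (subst (_∈ H₁.V) (sym (map₁ v)) (h₁.f∈ v)))
           , (λ v → ∈-++⁺ʳ H₁.V (subst (_∈ H₂.V) (sym (map₂ v)) (h₂.f∈ v))) ]′ ∘ ∈-++⁻ A₁.V
    ; edges = λ _ _ → edges
    ; label = [ label₁ , label₂ ]′ ∘ ∈-++⁻ A₁.V
    ; left = λ _ l → subst (_∈ H₁.L) (sym (map₁ (wA₁.L⊆V l))) (h₁.left (wA₁.L⊆V l) l)
    ; right = λ _ r → subst (_∈ H₂.R) (sym (map₂ (wA₂.R⊆V r))) (h₂.right (wA₂.R⊆V r) r)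
    }
    where
    edges : UnionEdge A₁ A₂ x y → UnionEdge H₁ H₂ (map x) (map y)
    edges (inl e) = let (x∈ , y∈) = wA₁.E-V e in
      inl (subst₂ H₁.E (sym (map₁ x∈)) (sym (map₁ y∈)) (h₁.edges x∈ y∈ e))
    edges (inr e) = let (x∈ , y∈) = wA₂.E-V e in
      inr (subst₂ H₂.E (sym (map₂ x∈)) (sym (map₂ y∈)) (h₂.edges x∈ y∈ e))
    label₁ : x ∈ A₁.V → IGraph.φ (glue H₁ H₂) (map x) ≡ IGraph.φ (glue A₁ A₂) x
    label₁ v = trans (cong (IGraph.φ (glue H₁ H₂)) (map₁ v))
      (trans (glue-φˡ H₁ H₂ (h₁.f∈ v)) (trans (h₁.label v) (sym (glue-φˡ A₁ A₂ v))))
    label₂ : x ∈ A₂.V → IGraph.φ (glue H₁ H₂) (map x) ≡ IGraph.φ (glue A₁ A₂) x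
    label₂ v = trans (cong (IGraph.φ (glue H₁ H₂)) (map₂ v))
      (trans (glue-φʳ cH (h₂.f∈ v)) (trans (h₂.label v) (sym (glue-φʳ cA v))))

glue-cong : {A₁ A₂ H₁ H₂ : IGraph k} →
  WellFormed A₁ → WellFormed A₂ → WellFormed H₁ → WellFormed H₂ →
  Compatible A₁ A₂ → Compatible H₁ H₂ →
  A₁ ≅ H₁ → A₂ ≅ H₂ → glue A₁ A₂ ≅ glue H₁ H₂
glue-cong {A₁ = A₁} {H₁ = H₁} wA₁ wA₂ wH₁ wH₂ cA cH i₁ i₂ =
  inverseHoms⇒≅ F.hom B.hom
    ([ (λ v → trans (cong B.map (F.map₁ v)) (trans (B.map₁ (i₁.f∈ v)) (i₁.gf v)))
     , (λ v → trans (cong B.map (F.map₂ v)) (trans (B.map₂ (i₂.f∈ v)) (i₂.gf v))) ]′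
     ∘ ∈-++⁻ (IGraph.V A₁))
    ([ (λ v → trans (cong F.map (B.map₁ v)) (trans (F.map₁ (i₁.g∈ v)) (i₁.fg v)))
     , (λ v → trans (cong F.map (B.map₂ v)) (trans (F.map₂ (i₂.g∈ v)) (i₂.fg v))) ]′
     ∘ ∈-++⁻ (IGraph.V H₁))
  where
  module i₁ = _≅_ i₁
  module i₂ = _≅_ i₂
  module F = GlueHom wA₁ wA₂ wH₂ cA cH (≅⇒Hom i₁) (≅⇒Hom i₂)
  module B = GlueHom wH₁ wH₂ wA₂ cH cA (≅⇒Hom⁻¹ i₁) (≅⇒Hom⁻¹ i₂)

≅-boundary : {G H : IGraph k} (i : G ≅ H) →
  x ∈ IGraph.V G → x ∈ boundary G ⇔ _≅_.f i x ∈ boundary H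
≅-boundary {G = G} {H} i v = mk⇔
  ([ ∈-++⁺ˡ ∘ to (left v) , ∈-++⁺ʳ (IGraph.L H) ∘ to (right v) ]′ ∘ ∈-++⁻ (IGraph.L G))
  ([ ∈-++⁺ˡ ∘ from (left v) , ∈-++⁺ʳ (IGraph.L G) ∘ from (right v) ]′ ∘ ∈-++⁻ (IGraph.L H))
  where open _≅_ i

abs-hom : {G H : IGraph k} → WellFormed G → G ≅ H → Hom (abs G) (abs H)
abs-hom {G = G} {H} w i = record
  { f = f
  ; f∈ = f∈∂
  ; edges = λ b b′ (x≢y , _ , _ , p) →
      x≢y ∘ injective b b′ , f∈∂ b , f∈∂ b′ , AvoidPath-map f edge-map avoid-map p
  ; label = λ b → label (boundary⊆V w b)
  ; left = λ b → to (left (boundary⊆V w b))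
  ; right = λ b → to (right (boundary⊆V w b))
  }
  where
  open _≅_ i
  open WellFormed w using (E-V)
  f∈∂ : x ∈ boundary G → f x ∈ boundary H
  f∈∂ b = to (≅-boundary i (boundary⊆V w b)) b
  injective : x ∈ boundary G → y ∈ boundary G → f x ≡ f y → x ≡ y
  injective b b′ fx≡fy =
    trans (sym (gf (boundary⊆V w b))) (trans (cong g fx≡fy) (gf (boundary⊆V w b′)))
  edge-map : IGraph.E G x y → IGraph.E H (f x) (f y)
  edge-map e = to (uncurry edges (E-V e)) e
  avoid-map : IGraph.E G x y → y ∉ boundary G → f y ∉ boundary H
  avoid-map e y∉ = y∉ ∘ from (≅-boundary i (proj₂ (E-V e)))

abs-cong : {G H : IGraph k} → WellFormed G → WellFormed H → G ≅ H → abs G ≅ abs H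
abs-cong wG wH i = inverseHoms⇒≅ (abs-hom wG i) (abs-hom wH (≅-sym i))
  (λ b → gf (boundary⊆V wG b)) (λ b → fg (boundary⊆V wH b))
  where open _≅_ i

module TorsoOfGlue {k : ℕ} {G₁ G₂ : IGraph k}
  (w₁ : WellFormed G₁) (w₂ : WellFormed G₂) (c : Compatible G₁ G₂) where

  private
    module G₁ = IGraph G₁
    module G₂ = IGraph G₂
    module w₁ = WellFormed w₁
    module w₂ = WellFormed w₂
    B₁ = boundary G₁
    B₂ = boundary G₂
    X = boundary (glue G₁ G₂)
    Reach = ReflClosure (AvoidPath (glue (abs G₁) (abs G₂)) X)

  onBoundary : x ∈ X → x ∈ B₁ ⊎ x ∈ B₂
  onBoundary = glue-boundary⊆ {G₁ = G₁} {G₂}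

  onBoundary₁ : x ∈ G₁.V → x ∈ B₁ ⊎ x ∈ B₂ → x ∈ B₁
  onBoundary₁ _ (inj₁ b) = b
  onBoundary₁ v (inj₂ b) = shared⊆boundaryˡ c v (boundary⊆V w₂ b)

  onBoundary₂ : x ∈ G₂.V → x ∈ B₁ ⊎ x ∈ B₂ → x ∈ B₂
  onBoundary₂ v (inj₁ b) = shared⊆boundaryʳ c (boundary⊆V w₁ b) v
  onBoundary₂ _ (inj₂ b) = b

  lift₁ : AvoidPath G₁ B₁ x y → AvoidPath (glue G₁ G₂) X x y
  lift₁ = AvoidPath-map id inl λ e z∉ → z∉ ∘ onBoundary₁ (proj₂ (w₁.E-V e)) ∘ onBoundary

  lift₂ : AvoidPath G₂ B₂ x y → AvoidPath (glue G₁ G₂) X x y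
  lift₂ = AvoidPath-map id inr λ e z∉ → z∉ ∘ onBoundary₂ (proj₂ (w₂.E-V e)) ∘ onBoundary

  expand : AvoidPath (glue (abs G₁) (abs G₂)) X x y → AvoidPath (glue G₁ G₂) X x y
  expand (edge (inl (_ , _ , _ , p))) = lift₁ p
  expand (edge (inr (_ , _ , _ , p))) = lift₂ p
  expand (step (inl (_ , _ , _ , p)) z∉ q) = append (lift₁ p) z∉ (expand q)
  expand (step (inr (_ , _ , _ , p)) z∉ q) = append (lift₂ p) z∉ (expand q)

  torsoStep₁ : x ∈ B₁ → y ∈ B₁ → AvoidPath G₁ B₁ x y → Reach x y
  torsoStep₁ {x} {y} x∈ y∈ p with x ≟ y
  ... | yes refl = refl
  ... | no x≢y = [ edge (inl (x≢y , x∈ , y∈ , p)) ]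

  torsoStep₂ : x ∈ B₂ → y ∈ B₂ → AvoidPath G₂ B₂ x y → Reach x y
  torsoStep₂ {x} {y} x∈ y∈ p with x ≟ y
  ... | yes refl = refl
  ... | no x≢y = [ edge (inr (x≢y , x∈ , y∈ , p)) ]

  -- contractᵢ carries a segment s of Gᵢ from x ∈ Bᵢ to z whose interior avoids
  -- Bᵢ; it is closed as a torso edge as soon as the walk reaches Bᵢ.  While z is
  -- off Bᵢ it is not shared, so the walk cannot leave Gᵢ (continueᵢ).
  mutual
    contract : x ∈ B₁ ⊎ x ∈ B₂ → y ∈ X → AvoidPath (glue G₁ G₂) X x y → Reach x y
    contract x∈ y∈ (edge (inl e)) = let (x∈V , y∈V) = w₁.E-V e in
      torsoStep₁ (onBoundary₁ x∈V x∈) (onBoundary₁ y∈V (onBoundary y∈)) (edge e)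
    contract x∈ y∈ (edge (inr e)) = let (x∈V , y∈V) = w₂.E-V e in
      torsoStep₂ (onBoundary₂ x∈V x∈) (onBoundary₂ y∈V (onBoundary y∈)) (edge e)
    contract x∈ y∈ (step (inl e) z∉ p) = let (x∈V , z∈V) = w₁.E-V e in
      contract₁ (onBoundary₁ x∈V x∈) (edge e) z∈V z∉ y∈ p
    contract x∈ y∈ (step (inr e) z∉ p) = let (x∈V , z∈V) = w₂.E-V e in
      contract₂ (onBoundary₂ x∈V x∈) (edge e) z∈V z∉ y∈ p

    contract₁ : x ∈ B₁ → AvoidPath G₁ B₁ x z → z ∈ G₁.V → z ∉ X → y ∈ X →
      AvoidPath (glue G₁ G₂) X z y → Reach x y
    contract₁ {z = z} x∈ s z∈V z∉ y∈ p with z ∈? B₁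
    ... | yes z∈ = reflAppend (torsoStep₁ x∈ z∈ s) z∉ (contract (inj₁ z∈) y∈ p)
    ... | no z∉B = continue₁ x∈ s z∉B z∈V y∈ p

    continue₁ : x ∈ B₁ → AvoidPath G₁ B₁ x z → z ∉ B₁ → z ∈ G₁.V → y ∈ X →
      AvoidPath (glue G₁ G₂) X z y → Reach x y
    continue₁ x∈ s z∉ z∈V y∈ (edge (inl e)) =
      torsoStep₁ x∈ (onBoundary₁ (proj₂ (w₁.E-V e)) (onBoundary y∈)) (append s z∉ (edge e))
    continue₁ x∈ s z∉ z∈V y∈ (step (inl e) z′∉ p) =
      contract₁ x∈ (append s z∉ (edge e)) (proj₂ (w₁.E-V e)) z′∉ y∈ p
    continue₁ x∈ s z∉ z∈V y∈ (edge (inr e)) =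
      ⊥-elim (z∉ (shared⊆boundaryˡ c z∈V (proj₁ (w₂.E-V e))))
    continue₁ x∈ s z∉ z∈V y∈ (step (inr e) _ _) =
      ⊥-elim (z∉ (shared⊆boundaryˡ c z∈V (proj₁ (w₂.E-V e))))

    contract₂ : x ∈ B₂ → AvoidPath G₂ B₂ x z → z ∈ G₂.V → z ∉ X → y ∈ X →
      AvoidPath (glue G₁ G₂) X z y → Reach x y
    contract₂ {z = z} x∈ s z∈V z∉ y∈ p with z ∈? B₂
    ... | yes z∈ = reflAppend (torsoStep₂ x∈ z∈ s) z∉ (contract (inj₂ z∈) y∈ p)
    ... | no z∉B = continue₂ x∈ s z∉B z∈V y∈ p

    continue₂ : x ∈ B₂ → AvoidPath G₂ B₂ x z → z ∉ B₂ → z ∈ G₂.V → y ∈ X →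
      AvoidPath (glue G₁ G₂) X z y → Reach x y
    continue₂ x∈ s z∉ z∈V y∈ (edge (inr e)) =
      torsoStep₂ x∈ (onBoundary₂ (proj₂ (w₂.E-V e)) (onBoundary y∈)) (append s z∉ (edge e))
    continue₂ x∈ s z∉ z∈V y∈ (step (inr e) z′∉ p) =
      contract₂ x∈ (append s z∉ (edge e)) (proj₂ (w₂.E-V e)) z′∉ y∈ p
    continue₂ x∈ s z∉ z∈V y∈ (edge (inl e)) =
      ⊥-elim (z∉ (shared⊆boundaryʳ c (proj₁ (w₁.E-V e)) z∈V))
    continue₂ x∈ s z∉ z∈V y∈ (step (inl e) _ _) =
      ⊥-elim (z∉ (shared⊆boundaryʳ c (proj₁ (w₁.E-V e)) z∈V))

  torsoEdge⇔ : TorsoEdge (glue G₁ G₂) X x y ⇔ TorsoEdge (glue (abs G₁) (abs G₂)) X x y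
  torsoEdge⇔ = mk⇔
    (λ (x≢y , x∈ , y∈ , p) → x≢y , x∈ , y∈ , reachPath x≢y (contract (onBoundary x∈) y∈ p))
    (λ (x≢y , x∈ , y∈ , p) → x≢y , x∈ , y∈ , expand p)
    where
    reachPath : x ≢ y → Reach x y → AvoidPath (glue (abs G₁) (abs G₂)) X x y
    reachPath x≢x refl = ⊥-elim (x≢x refl)
    reachPath _ [ p ] = p

  boundary-φ : x ∈ X → IGraph.φ (glue (abs G₁) (abs G₂)) x ≡ IGraph.φ (glue G₁ G₂) x
  boundary-φ = [ (λ b → trans (glue-φˡ (abs G₁) (abs G₂) b)
                               (sym (glue-φˡ G₁ G₂ (boundary⊆V w₁ b))))
               , (λ b → trans (glue-φʳ (abs-compatible w₁ w₂ c) b)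
                               (sym (glue-φʳ c (boundary⊆V w₂ b)))) ]′
               ∘ onBoundary

abs-glue : {G₁ G₂ : IGraph k} → WellFormed G₁ → WellFormed G₂ → Compatible G₁ G₂ →
  abs (glue G₁ G₂) ≅ abs (glue (abs G₁) (abs G₂))
abs-glue w₁ w₂ c = record
  { f = id ; g = id ; f∈ = id ; g∈ = id ; gf = λ _ → refl ; fg = λ _ → refl
  ; edges = λ _ _ → torsoEdge⇔
  ; label = boundary-φ
  ; left = λ _ → ⇔-id _
  ; right = λ _ → ⇔-id _
  }
  where open TorsoOfGlue w₁ w₂ c

mainTheorem4 : {k : ℕ} → .{{_ : NonZero k}} → (G₁ G₂ H₁ H₂ : IGraph k) →
    WellFormed G₁ → WellFormed G₂ → Compatible G₁ G₂ →
    WellFormed H₁ → WellFormed H₂ → Compatible H₁ H₂ →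
    H₁ ≅ abs G₁ → H₂ ≅ abs G₂ →
    abs (glue G₁ G₂) ≅ abs (glue H₁ H₂)
mainTheorem4 G₁ G₂ H₁ H₂ wG₁ wG₂ cG wH₁ wH₂ cH iso₁ iso₂ =
  ≅-trans (abs-glue wG₁ wG₂ cG)
    (abs-cong (glue-wellFormed wA₁ wA₂ cA) (glue-wellFormed wH₁ wH₂ cH)
      (glue-cong wA₁ wA₂ wH₁ wH₂ cA cH (≅-sym iso₁) (≅-sym iso₂)))
  where
  wA₁ = abs-wellFormed wG₁
  wA₂ = abs-wellFormed wG₂
  cA = abs-compatible wG₁ wG₂ cG
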